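{- Let $W=\langle\{r,k\},\le,D,J,v\rangle\in\mathcal{W}_{\mathrm P2}$ with $r<k$, and let $W_\emptyset=\langle\{r,k\},\le,D,J,v_\emptyset\rangle$ where $P^{v_\emptyset(r)}=\emptyset$ and $P^{v_\emptyset(k)}=P^{v(k)}$ for every predicate $P$. Then for every closed $\mathcal{L}(D)$-formula $A$: (i) $k\models_{W_\emptyset}A$ iff $k\models_WA$; (ii) $r\models_{W_\emptyset}A$ implies $r\models_WA$. Moreover (iii) for every closed $\mathcal{L}$-formula $A$, $\models^V_{\mathcal{W}_{\mathrm P2}}A$ iff $\models^V_{\mathcal{W}_{\mathrm P2\emptyset}}A$.
   Context: Language: $\mathcal{L}$ is a first-order language with $\top,\bot$, connectives $\land,\lor,\to,\neg$ ($\neg$ primitive, distinct from $A\to\bot$), $\forall,\exists$, countably many variables, constants, function and predicate symbols, including a distinguished unary predicate $E$. $\mathcal{L}(D)$ adds constants $\overline d$ for $d\in D$. GN formulas: $N::=\bot\mid\neg A\mid N\land N\mid N\lor N\mid N\to N\mid\forall xN\mid\exists xN$; $\forall xA$/$\exists xA$ is global if $x$ occurs free in $A$ and all its free occurrences lie inside GN subformulas, local otherwise. Strict finitistic model $W=\langle K,\le,D,J,v\rangle$: rooted tree (countable branching, height $\le\omega$), nonempty constant domain $D$, compositional interpretation $J$ of closed $\mathcal{L}(D)$-terms with $J(\overline d)=d$, monotone extensions $P^{v(k)}\subseteq D^n$, strictness (values of all subterms of arguments of an atom true at a node lie in $E$'s extension there), finite verification (finitely many predicates with nonempty extension per node). Forcing: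 atoms via $v(k)$; $\top$ forced, $\bot$ not; $\land,\lor$ componentwise; $k\models A\to B$ iff every $k'\ge k$ forcing $A$ has some $k''\ge k'$ forcing $B$; $k\models\neg A$ iff no node forces $A$; $k\models\forall xA$ iff for all $d$, $k\models\top\to A[\overline d/x]$ (global) or $k\models E(\overline d)\to A[\overline d/x]$ (local); $k\models\exists xA$ iff for some $d$, $k\models A[\overline d/x]$ (global) or $k\models E(\overline d)\land A[\overline d/x]$ (local). $\models^V_WA$: forced at all nodes. $W$ is prevalent if every closed $\mathcal{L}(D)$-formula forced somewhere is prevalent (for each node some node above-or-equal forces it) and each $E(\overline d)$ is prevalent. $\mathcal{W}_{\mathrm P2}$: prevalent models with exactly two nodes $r<k$; $\mathcal{W}_{\mathrm P2\emptyset}$: those members of $\mathcal{W}_{\mathrm P2}$ whose root forces no $E(c)$, $c$ a closed $\mathcal{L}(D)$-term. $\models^V_{\mathcal{C}}A$: valid in every model in $\mathcal{C}$. -}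

module Defs where

open import Data.Nat using (ℕ; zero; suc; _⊔_; _≡ᵇ_)
open import Data.Bool using (Bool; true; false; _∧_; _∨_; not; if_then_else_)
open import Data.Maybe using (Maybe; just; nothing; _>>=_)
open import Data.Vec using (Vec; []; _∷_)
open import Data.Vec.Relation.Unary.Any using (Any)
open import Data.List using (List)
open import Data.List.Membership.Propositional using (_∈_)
open import Data.Product using (Σ; _×_; _,_)
open import Data.Sum using (_⊎_)
open import Data.Empty using (⊥; ⊥-elim)
open import Data.Unit using (⊤; tt)
open import Relation.Nullary using (¬_)
open import Relation.Binary.PropositionalEquality using (_≡_)

-- Function symbols: for every arity n and index i a symbol f^n_i
-- (constants of L are the 0-ary function symbols f^0_i).

data Pred : Set where
  E : Pred
  P : (n i : ℕ) → Pred

arity : Pred → ℕ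
arity E = 1
arity (P n i) = n

data Term (D : Set) : Set where
  var : ℕ → Term D
  con : D → Term D
  app : (n i : ℕ) → Vec (Term D) n → Term D

-- Formulas of L(D); ¬ is primitive (distinct from A ⇒ ⊥).
data Formula (D : Set) : Set where
  ⊤' ⊥' : Formula D
  atom : (p : Pred) → Vec (Term D) (arity p) → Formula D
  _∧'_ _∨'_ _⇒_ : Formula D → Formula D → Formula D
  ¬' : Formula D → Formula D
  all ex : ℕ → Formula D → Formula D

-- Embedding of L-formulas (= L(⊥)-formulas, no constants d̄) into L(D).

mutual
  embT : {D : Set} → Term ⊥ → Term D
  embT (var x) = var x
  embT (con ())
  embT (app n i ts) = app n i (embTs ts)

  embTs : {D : Set} {n : ℕ} → Vec (Term ⊥) n → Vec (Term D) n
  embTs [] = []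
  embTs (t ∷ ts) = embT t ∷ embTs ts

embF : {D : Set} → Formula ⊥ → Formula D
embF ⊤' = ⊤'
embF ⊥' = ⊥'
embF (atom p ts) = atom p (embTs ts)
embF (A ∧' B) = embF A ∧' embF B
embF (A ∨' B) = embF A ∨' embF B
embF (A ⇒ B) = embF A ⇒ embF B
embF (¬' A) = ¬' (embF A)
embF (all x A) = all x (embF A)
embF (ex x A) = ex x (embF A)

module _ {D : Set} where

  mutual
    occT : ℕ → Term D → Bool
    occT x (var y) = x ≡ᵇ y
    occT x (con d) = false
    occT x (app n i ts) = occTs x ts

    occTs : {n : ℕ} → ℕ → Vec (Term D) n → Bool
    occTs x [] = false
    occTs x (t ∷ ts) = occT x t ∨ occTs x ts

  occF : ℕ → Formula D → Bool
  occF x ⊤' = false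
  occF x ⊥' = false
  occF x (atom p ts) = occTs x ts
  occF x (A ∧' B) = occF x A ∨ occF x B
  occF x (A ∨' B) = occF x A ∨ occF x B
  occF x (A ⇒ B) = occF x A ∨ occF x B
  occF x (¬' A) = occF x A
  occF x (all y A) = if x ≡ᵇ y then false else occF x A
  occF x (ex y A) = if x ≡ᵇ y then false else occF x A

  ClosedT : Term D → Set
  ClosedT t = ∀ x → occT x t ≡ false

  Closed : Formula D → Set
  Closed A = ∀ x → occF x A ≡ false

  mutual
    substT : ℕ → D → Term D → Term D
    substT x d (var y) = if x ≡ᵇ y then con d else var y
    substT x d (con e) = con e
    substT x d (app n i ts) = app n i (substTs x d ts)

    substTs : {n : ℕ} → ℕ → D → Vec (Term D) n → Vec (Term D) n
    substTs x d [] = []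
    substTs x d (t ∷ ts) = substT x d t ∷ substTs x d ts

  _[_/_] : Formula D → D → ℕ → Formula D
  ⊤' [ d / x ] = ⊤'
  ⊥' [ d / x ] = ⊥'
  atom p ts [ d / x ] = atom p (substTs x d ts)
  (A ∧' B) [ d / x ] = (A [ d / x ]) ∧' (B [ d / x ])
  (A ∨' B) [ d / x ] = (A [ d / x ]) ∨' (B [ d / x ])
  (A ⇒ B) [ d / x ] = (A [ d / x ]) ⇒ (B [ d / x ])
  ¬' A [ d / x ] = ¬' (A [ d / x ])
  all y A [ d / x ] = if x ≡ᵇ y then all y A else all y (A [ d / x ])
  ex y A [ d / x ] = if x ≡ᵇ y then ex y A else ex y (A [ d / x ])

  isGN : Formula D → Bool
  isGN ⊥' = true
  isGN (¬' A) = true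
  isGN (A ∧' B) = isGN A ∧ isGN B
  isGN (A ∨' B) = isGN A ∧ isGN B
  isGN (A ⇒ B) = isGN A ∧ isGN B
  isGN (all x A) = isGN A
  isGN (ex x A) = isGN A
  isGN ⊤' = false
  isGN (atom p ts) = false

  freeInGN : ℕ → Formula D → Bool
  freeInGN x ⊤' = true
  freeInGN x ⊥' = true
  freeInGN x (atom p ts) = not (occTs x ts)
  freeInGN x (A ∧' B) = isGN (A ∧' B) ∨ (freeInGN x A ∧ freeInGN x B)
  freeInGN x (A ∨' B) = isGN (A ∨' B) ∨ (freeInGN x A ∧ freeInGN x B)
  freeInGN x (A ⇒ B) = isGN (A ⇒ B) ∨ (freeInGN x A ∧ freeInGN x B)
  freeInGN x (¬' A) = true
  freeInGN x (all y A) = isGN (all y A) ∨ (if x ≡ᵇ y then true else freeInGN x A)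
  freeInGN x (ex y A) = isGN (ex y A) ∨ (if x ≡ᵇ y then true else freeInGN x A)

  global : ℕ → Formula D → Bool
  global x A = occF x A ∧ freeInGN x A

  -- height of a formula (used only as fuel for the forcing recursion)
  height : Formula D → ℕ
  height ⊤' = 0
  height ⊥' = 0
  height (atom p ts) = 0
  height (A ∧' B) = suc (height A ⊔ height B)
  height (A ∨' B) = suc (height A ⊔ height B)
  height (A ⇒ B) = suc (height A ⊔ height B)
  height (¬' A) = suc (height A)
  height (all x A) = suc (height A)
  height (ex x A) = suc (height A)

  data _⊑_ : Term D → Term D → Set where
    ⊑-refl : ∀ {t} → t ⊑ t
    ⊑-app : ∀ {s t n i} {ts : Vec (Term D) n} → s ⊑ t → Any (t ≡_) ts → s ⊑ app n i ts

data Node : Set where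
  r k : Node

data _≤N_ : Node → Node → Set where
  r≤r : r ≤N r
  r≤k : r ≤N k
  k≤k : k ≤N k

-- Raw two-node structure ⟨{r,k}, ≤, D, J, v⟩.  J is the compositional
-- interpretation of closed L(D)-terms generated by the interpretations
-- `fun` of the function symbols, with J(d̄) = d.
record Structure : Set₁ where
  field
    D   : Set
    fun : (n i : ℕ) → Vec D n → D
    v   : Node → (p : Pred) → Vec D (arity p) → Set

module _ (S : Structure) where
  open Structure S

  mutual
    -- J on terms: defined (just) exactly on closed terms
    J : Term D → Maybe D
    J (var x) = nothing
    J (con d) = just d
    J (app n i ts) = Js ts >>= λ ds → just (fun n i ds)

    Js : {n : ℕ} → Vec (Term D) n → Maybe (Vec D n)
    Js [] = just []
    Js (t ∷ ts) = J t >>= λ d → Js ts >>= λ ds → just (d ∷ ds)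

  Imp : (Node → Set) → (Node → Set) → Node → Set
  Imp Q1 Q2 n = ∀ n' → n ≤N n' → Q1 n' → Σ Node λ n'' → n' ≤N n'' × Q2 n''

  -- forcing, with fuel (fuel = height suffices; substitution preserves height)
  Forces : ℕ → Node → Formula D → Set
  Forces _ n ⊤' = ⊤
  Forces _ n ⊥' = ⊥
  Forces _ n (atom p ts) = Σ (Vec D (arity p)) λ ds → (Js ts ≡ just ds) × v n p ds
  Forces (suc m) n (A ∧' B) = Forces m n A × Forces m n B
  Forces (suc m) n (A ∨' B) = Forces m n A ⊎ Forces m n B
  Forces (suc m) n (A ⇒ B) = Imp (λ n' → Forces m n' A) (λ n' → Forces m n' B) n
  Forces (suc m) n (¬' A) = ∀ n' → ¬ Forces m n' A
  Forces (suc m) n (all x A) =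
    if global x A
    then (∀ d → Imp (λ _ → ⊤) (λ n' → Forces m n' (A [ d / x ])) n)
    else (∀ d → Imp (λ n' → Forces 0 n' (atom E (con d ∷ []))) (λ n' → Forces m n' (A [ d / x ])) n)
  Forces (suc m) n (ex x A) =
    if global x A
    then (Σ D λ d → Forces m n (A [ d / x ]))
    else (Σ D λ d → Forces 0 n (atom E (con d ∷ [])) × Forces m n (A [ d / x ]))
  Forces zero n _ = ⊥

  _⊩_ : Node → Formula D → Set
  n ⊩ A = Forces (height A) n A

  Valid : Formula D → Set
  Valid A = ∀ n → n ⊩ A

  record IsModel : Set where
    field
      nonempty : D
      monotone : ∀ p ds → v r p ds → v k p ds
      strict   : ∀ n p (ts : Vec (Term D) (arity p)) ds → Js ts ≡ just ds → v n p ds →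
                 ∀ s → Any (s ⊑_) ts → Σ D λ e → (J s ≡ just e) × v n E (e ∷ [])
      finiteVer : ∀ n → Σ (List Pred) λ L → ∀ p ds → v n p ds → p ∈ L

  Prevalent : Set
  Prevalent =
    (∀ A → Closed A → (Σ Node λ n → n ⊩ A) → ∀ n → Σ Node λ n' → n ≤N n' × n' ⊩ A)
    × (∀ d n → Σ Node λ n' → n ≤N n' × n' ⊩ atom E (con d ∷ []))

  InP2 : Set
  InP2 = IsModel × Prevalent

  InP2∅ : Set
  InP2∅ = InP2 × (∀ c → ClosedT c → ¬ (r ⊩ atom E (c ∷ [])))

emptyRoot : Structure → Structure
emptyRoot S = record
  { D = Structure.D S
  ; fun = Structure.fun S
  ; v = λ { r p ds → ⊥ ; k p ds → Structure.v S k p ds }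
  }

ValidP2 : Formula ⊥ → Set₁
ValidP2 A = ∀ S → InP2 S → Valid S (embF A)

ValidP2∅ : Formula ⊥ → Set₁
ValidP2∅ A = ∀ S → InP2∅ S → Valid S (embF A)

{-# OPTIONS --safe #-}
-- In the frame r < k the only node above k is k itself, so forcing at k depends
-- on v(k) alone: implications and universal statements at k only look at k, and
-- a negation, which looks at every node, can be pushed up to k by persistence.
-- Hence W and W∅ force the same formulas at k.  At the root W∅ forces no atom;
-- implications, negations and universal statements at r are decided at k (their
-- antecedents persist), and the remaining connectives act componentwise, so
-- root forcing in W∅ implies root forcing in W.  Finally W∅ lies in 𝒲_P2∅, so
-- validity over 𝒲_P2∅ transfers to every W ∈ 𝒲_P2 through (i) and (ii).
module Submission where

open import Defs
open import Data.Bool using (true; false)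
open import Data.Empty using (⊥)
open import Data.List using ([])
open import Data.Maybe using (just)
open import Data.Nat using (zero; suc)
open import Data.Product using (Σ; _×_; _,_; proj₁)
open import Data.Sum using (inj₁; inj₂)
open import Data.Vec using (Vec; []; _∷_)
open import Data.Vec.Relation.Unary.Any using (Any)
open import Function.Base using (id; _∘_)
open import Function.Bundles using (_⇔_; mk⇔; Equivalence)
open import Function.Construct.Identity using (⇔-id)
open import Function.Construct.Symmetry using (⇔-sym)
open import Relation.Binary.PropositionalEquality using (_≡_; refl; sym; trans)

≤N-top : ∀ n → n ≤N k
≤N-top r = r≤k
≤N-top k = k≤k

above-top : ∀ {P : Node → Set} → Σ Node (λ n → k ≤N n × P n) → P k
above-top (.k , k≤k , p) = p

Valuation : Structure → Set₁
Valuation S = Node → (p : Pred) → Vec (Structure.D S) (arity p) → Set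

revalue : (S : Structure) → Valuation S → Structure
revalue S v′ = record S { v = v′ }

Monotone : Structure → Set
Monotone S = ∀ p ds → v r p ds → v k p ds
  where open Structure S

module _ (S : Structure) where

  Imp-persistent : ∀ {Q₁ Q₂} → Imp S Q₁ Q₂ r → Imp S Q₁ Q₂ k
  Imp-persistent f .k k≤k q = f k r≤k q

  Imp-top-map : ∀ {Q₁ Q₂ Q₁′ Q₂′} → (Q₁′ k → Q₁ k) → (Q₂ k → Q₂′ k) →
                Imp S Q₁ Q₂ k → Imp S Q₁′ Q₂′ k
  Imp-top-map g h f .k k≤k q = k , k≤k , h (above-top (f k k≤k (g q)))

  Imp-root : ∀ {Q₁ Q₂} → (Q₁ r → Q₁ k) → Imp S Q₁ Q₂ k → Imp S Q₁ Q₂ r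
  Imp-root up f r r≤r q = k , r≤k , above-top (f k k≤k (up q))
  Imp-root up f k r≤k q = f k k≤k q

  module _ (mono : Monotone S) where

    persist : ∀ m A → Forces S m r A → Forces S m k A
    persist m ⊤' x = x
    persist m ⊥' x = x
    persist m (atom p ts) (ds , eq , x) = ds , eq , mono p ds x
    persist zero (A ∧' B) ()
    persist zero (A ∨' B) ()
    persist zero (A ⇒ B) ()
    persist zero (¬' A) ()
    persist zero (all x A) ()
    persist zero (ex x A) ()
    persist (suc m) (A ∧' B) (a , b) = persist m A a , persist m B b
    persist (suc m) (A ∨' B) (inj₁ a) = inj₁ (persist m A a)
    persist (suc m) (A ∨' B) (inj₂ b) = inj₂ (persist m B b)
    persist (suc m) (A ⇒ B) f = Imp-persistent f
    persist (suc m) (¬' A) f = f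
    persist (suc m) (all x A) f with global x A
    ... | true = λ d → Imp-persistent (f d)
    ... | false = λ d → Imp-persistent (f d)
    persist (suc m) (ex x A) f with global x A
    persist (suc m) (ex x A) (d , a) | true = d , persist m (A [ d / x ]) a
    persist (suc m) (ex x A) (d , e , a) | false =
      d , persist 0 (atom E (con d ∷ [])) e , persist m (A [ d / x ]) a

    persist-top : ∀ m A n → Forces S m n A → Forces S m k A
    persist-top m A r = persist m A
    persist-top m A k = id

module _ (S : Structure) (v′ : Valuation S) where

  mutual
    J-revalue : ∀ t → J (revalue S v′) t ≡ J S t
    J-revalue (var x) = refl
    J-revalue (con d) = refl
    J-revalue (app n i ts) rewrite Js-revalue ts = refl

    Js-revalue : ∀ {n} (ts : Vec (Term (Structure.D S)) n) → Js (revalue S v′) ts ≡ Js S ts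
    Js-revalue [] = refl
    Js-revalue (t ∷ ts) rewrite J-revalue t | Js-revalue ts = refl

record SameAtTop (S : Structure) (v′ : Valuation S) : Set where
  field
    monotone  : Monotone S
    monotone′ : Monotone (revalue S v′)
    agree     : ∀ p ds → Structure.v S k p ds ⇔ v′ k p ds

  swap : SameAtTop (revalue S v′) (Structure.v S)
  swap = record
    { monotone = monotone′ ; monotone′ = monotone ; agree = λ p ds → ⇔-sym (agree p ds) }

open SameAtTop

mutual
  forces-top-transfer : ∀ {S v′} → SameAtTop S v′ →
                        ∀ m A → Forces S m k A → Forces (revalue S v′) m k A
  forces-top-transfer h m ⊤' x = x
  forces-top-transfer h m ⊥' x = x
  forces-top-transfer {S} {v′} h m (atom p ts) (ds , eq , x) =
    ds , trans (Js-revalue S v′ ts) eq , Equivalence.to (agree h p ds) x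
  forces-top-transfer h zero (A ∧' B) ()
  forces-top-transfer h zero (A ∨' B) ()
  forces-top-transfer h zero (A ⇒ B) ()
  forces-top-transfer h zero (¬' A) ()
  forces-top-transfer h zero (all x A) ()
  forces-top-transfer h zero (ex x A) ()
  forces-top-transfer h (suc m) (A ∧' B) (a , b) =
    forces-top-transfer h m A a , forces-top-transfer h m B b
  forces-top-transfer h (suc m) (A ∨' B) (inj₁ a) =
    inj₁ (forces-top-transfer h m A a)
  forces-top-transfer h (suc m) (A ∨' B) (inj₂ b) =
    inj₂ (forces-top-transfer h m B b)
  forces-top-transfer {S} h (suc m) (A ⇒ B) f =
    Imp-top-map S (forces-top-transfer⁻ h m A) (forces-top-transfer h m B) f
  forces-top-transfer {S} {v′} h (suc m) (¬' A) f n a =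
    f k (forces-top-transfer⁻ h m A (persist-top (revalue S v′) (monotone′ h) m A n a))
  forces-top-transfer {S} h (suc m) (all x A) f with global x A
  ... | true = λ d → Imp-top-map S id (forces-top-transfer h m (A [ d / x ])) (f d)
  ... | false = λ d →
    Imp-top-map S (forces-top-transfer⁻ h 0 (atom E (con d ∷ [])))
                  (forces-top-transfer h m (A [ d / x ])) (f d)
  forces-top-transfer h (suc m) (ex x A) f with global x A
  forces-top-transfer h (suc m) (ex x A) (d , a) | true =
    d , forces-top-transfer h m (A [ d / x ]) a
  forces-top-transfer h (suc m) (ex x A) (d , e , a) | false =
      d
    , forces-top-transfer h 0 (atom E (con d ∷ [])) e
    , forces-top-transfer h m (A [ d / x ]) a

  -- Revaluing revalue S v′ back to the valuation of S gives S again, by η for records.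
  forces-top-transfer⁻ : ∀ {S v′} → SameAtTop S v′ →
                         ∀ m A → Forces (revalue S v′) m k A → Forces S m k A
  forces-top-transfer⁻ h = forces-top-transfer (swap h)

forces-root-to-top : ∀ {S v′} → SameAtTop S v′ →
                     ∀ m A → Forces (revalue S v′) m r A → Forces S m k A
forces-root-to-top {S} {v′} h m A = forces-top-transfer⁻ h m A ∘ persist (revalue S v′) (monotone′ h) m A

forces-root-shrink : ∀ {S v′} → SameAtTop S v′ →
                     (∀ p ds → v′ r p ds → Structure.v S r p ds) →
                     ∀ m A → Forces (revalue S v′) m r A → Forces S m r A
forces-root-shrink h shrink m ⊤' x = x
forces-root-shrink h shrink m ⊥' x = x
forces-root-shrink {S} {v′} h shrink m (atom p ts) (ds , eq , x) =
  ds , trans (sym (Js-revalue S v′ ts)) eq , shrink p ds x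
forces-root-shrink h shrink zero (A ∧' B) ()
forces-root-shrink h shrink zero (A ∨' B) ()
forces-root-shrink h shrink zero (A ⇒ B) ()
forces-root-shrink h shrink zero (¬' A) ()
forces-root-shrink h shrink zero (all x A) ()
forces-root-shrink h shrink zero (ex x A) ()
forces-root-shrink h shrink (suc m) (A ∧' B) (a , b) =
  forces-root-shrink h shrink m A a , forces-root-shrink h shrink m B b
forces-root-shrink h shrink (suc m) (A ∨' B) (inj₁ a) =
  inj₁ (forces-root-shrink h shrink m A a)
forces-root-shrink h shrink (suc m) (A ∨' B) (inj₂ b) =
  inj₂ (forces-root-shrink h shrink m B b)
forces-root-shrink {S} h shrink (suc m) (A ⇒ B) f =
  Imp-root S (persist S (monotone h) m A) (forces-root-to-top h (suc m) (A ⇒ B) f)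
forces-root-shrink h shrink (suc m) (¬' A) f = forces-root-to-top h (suc m) (¬' A) f
forces-root-shrink {S} h shrink (suc m) (all x A) f
  with global x A | forces-root-to-top h (suc m) (all x A) f
... | true | g = λ d → Imp-root S id (g d)
... | false | g = λ d → Imp-root S (persist S (monotone h) 0 (atom E (con d ∷ []))) (g d)
forces-root-shrink h shrink (suc m) (ex x A) f with global x A
forces-root-shrink h shrink (suc m) (ex x A) (d , a) | true =
  d , forces-root-shrink h shrink m (A [ d / x ]) a
forces-root-shrink h shrink (suc m) (ex x A) (d , e , a) | false =
    d
  , forces-root-shrink h shrink 0 (atom E (con d ∷ [])) e
  , forces-root-shrink h shrink m (A [ d / x ]) a

module _ (S : Structure) where
  open Structure S

  emptyRoot-monotone : Monotone (emptyRoot S)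
  emptyRoot-monotone p ds ()

  emptyRoot-sameAtTop : Monotone S → SameAtTop S (Structure.v (emptyRoot S))
  emptyRoot-sameAtTop mono = record
    { monotone = mono ; monotone′ = emptyRoot-monotone ; agree = λ p ds → ⇔-id _ }

  emptyRoot-top : Monotone S → ∀ A → _⊩_ (emptyRoot S) k A ⇔ _⊩_ S k A
  emptyRoot-top mono A =
    mk⇔ (forces-top-transfer⁻ h (height A) A) (forces-top-transfer h (height A) A)
    where h = emptyRoot-sameAtTop mono

  emptyRoot-root : Monotone S → ∀ A → _⊩_ (emptyRoot S) r A → _⊩_ S r A
  emptyRoot-root mono A = forces-root-shrink (emptyRoot-sameAtTop mono) (λ p ds ()) (height A) A

  emptyRoot-reflects : Monotone S → ∀ n A → _⊩_ (emptyRoot S) n A → _⊩_ S n A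
  emptyRoot-reflects mono r A = emptyRoot-root mono A
  emptyRoot-reflects mono k A = Equivalence.to (emptyRoot-top mono A)

  emptyRoot-IsModel : IsModel S → IsModel (emptyRoot S)
  emptyRoot-IsModel model = record
    { nonempty = nonempty
    ; monotone = emptyRoot-monotone
    ; strict = strict′
    ; finiteVer = λ { r → [] , λ p ds () ; k → finiteVer k }
    }
    where
      open IsModel model
      v∅ : Valuation S
      v∅ = Structure.v (emptyRoot S)

      strict′ : ∀ n p (ts : Vec (Term D) (arity p)) ds →
                Js (emptyRoot S) ts ≡ just ds → v∅ n p ds →
                ∀ s → Any (s ⊑_) ts →
                Σ D λ e → (J (emptyRoot S) s ≡ just e) × v∅ n E (e ∷ [])
      strict′ r p ts ds eq ()
      strict′ k p ts ds eq x s s⊑ts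
        with strict k p ts ds (trans (sym (Js-revalue S v∅ ts)) eq) x s s⊑ts
      ... | e , Js≡e , Ee = e , trans (J-revalue S v∅ s) Js≡e , Ee

  emptyRoot-Prevalent : Prevalent S → Prevalent (emptyRoot S)
  emptyRoot-Prevalent (_ , E-prevalent) =
      (λ A _ (n , a) n′ →
         k , ≤N-top n′ , persist-top (emptyRoot S) emptyRoot-monotone (height A) A n a)
    -- E(d̄) at k means the same in S and W∅: J(d̄) = d and v(k) is unchanged.
    , λ d n → k , ≤N-top n , above-top (E-prevalent d k)

  emptyRoot-InP2∅ : InP2 S → InP2∅ (emptyRoot S)
  emptyRoot-InP2∅ (model , prevalent) =
    (emptyRoot-IsModel model , emptyRoot-Prevalent prevalent) , λ { c _ (ds , eq , ()) }

mainTheorem9 : ((S : Structure) → InP2 S →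
                  ((A : Formula (Structure.D S)) → Closed A →
                     (_⊩_ (emptyRoot S) k A ⇔ _⊩_ S k A))
                  × ((A : Formula (Structure.D S)) → Closed A →
                     _⊩_ (emptyRoot S) r A → _⊩_ S r A))
               × ((A : Formula ⊥) → Closed A → (ValidP2 A ⇔ ValidP2∅ A))
mainTheorem9 =
    (λ S (model , _) →
         (λ A _ → emptyRoot-top S (IsModel.monotone model) A)
       , (λ A _ → emptyRoot-root S (IsModel.monotone model) A))
  , λ A _ → mk⇔ (λ valid S inP2∅ → valid S (proj₁ inP2∅)) (reflect A)
  where
    reflect : ∀ A → ValidP2∅ A → ValidP2 A
    reflect A valid∅ S inP2 n =
      emptyRoot-reflects S (IsModel.monotone (proj₁ inP2)) n (embF A)
        (valid∅ (emptyRoot S) (emptyRoot-InP2∅ S inP2) n)
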